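{- Let $\Sigma=(V,E,\{P_e\}_{e\in E})$ be a signature, $\delta\in\Delta(\Sigma)$, $F\subseteq E$, and let $\langle X^e,\{f^e_u\}_{u\in Inc(e)}\rangle_{e\in E}$ be any run of the canonical protocol $\mathcal{P}^\delta_F$. If $h\in Edge(v,v')$, $h\in F\cap\mathcal{B}$ and $\delta_h\notin X^h$, then $f^h_v=0$ if and only if $\Box_h\delta\notin X^h$.
   Context: A signature is $\Sigma=(V,E,\{P_e\}_{e\in E})$ with $(V,E)$ a connected undirected graph (loops and multiple edges allowed) and $\{P_e\}$ pairwise disjoint sets of propositional letters; $Inc(v)$ is the set of edges incident to $v$, $Inc(e)$ the set of endpoints of $e$, and $e\in Edge(u,u')$ means $e$ is an edge between $u$ and $u'$. $\Phi(\Sigma)$ is the least set of formulas containing $\bot$ and all letters, closed under $\to$ and $\Box_e$ ($e\in E$), with $\neg,\vee$ defined as usual. For $T\subseteq E$, $\Phi(\Sigma,T)$ is the least set containing $\bot$, $P_t$ ($t\in T$), closed under $\to$, and containing $\Box_t\phi$ for $t\in T$ and any $\phi\in\Phi(\Sigma)$. Provability $\vdash$ is in the S5-style system (propositional tautologies, Truth, Positive/Negative Introspection, Distributivity for each $\Box_e$, plus Gateway axiom $\Box_e(\phi\to\psi)\to(\phi\to\Box_g\psi)$ for $g$ a gateway between $A,B$, $e\in A$, $\phi\in\Phi(\Sigma,A)$, $\psi\in\Phi(\Sigma,B)$, where $g$ is a gateway if every path of distinct edges/vertices from an edge in $A$ to an edge in $B$ contains $g$; rules Modus Ponens and Necessitation).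 A set $X$ is consistent if $\bot$ is not derivable from $X$ and theorems by Modus Ponens; a maximal consistent subset of $S$ is a consistent $X\subseteq S$ with no consistent proper extension inside $S$. $\Delta(\Sigma)$ is the set of formulas $\delta=\bigvee_{e\in E}\delta_e$ with $\delta_e\in\Phi(\Sigma,\{e\})$ for each $e$ ($\delta$ comes with its disjuncts $\delta_e$). An edge $b$ is a bridge if $(V,E\setminus\{b\})$ is disconnected; $\mathcal{B}$ is the set of bridges. For an edge $e$ and an endpoint $v$, $C^v_{ -e}$ is the connected component of $(V,E\setminus\{e\})$ containing $v$; $h\in C^v_{ -e}$ means $h$ is an edge of it. Canonical protocol $\mathcal{P}^\delta_F$ (a protocol: sets of values $W_e$, local conditions $L_v\subseteq\prod_{e\in Inc(v)}W_e$, valuation $p^\pi\subseteq W_e$ for $p\in P_e$; a run is a choice of a value for each edge satisfying all local conditions): a value of $e\in Edge(u,u')$ is a tuple $\langle X,\{f_v\}_{v\in Inc(e)}\rangle$ with (1a) $X$ a maximal consistent subset of $\Phi(\Sigma,\{e\})$; (1b) $f_u,f_{u'}$ real numbers; (1c) $f_u+f_{u'}>0$ iff $\delta_e\in X$; if $e\in\mathcal{B}$: (2a) if $\delta_e\notin X$ then $f_u+f_{u'}=0$; (2b) for an endpoint $u$, if $f_u<0$ then $\Box_e\bigvee_{h\in C^u_{ -e}}\delta_h\in X$; (2c) if $e\in F$, $\Box_e\delta\in X$ and $\delta_e\notin X$, then $f_u<0$ or $f_{u'}<0$; if $e\in E\setminus\mathcal{B}$: (3a) if $f_u+f_{u'}<0$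 then $\Box_e\delta\in X$; (3b) if $e\in F$, $\Box_e\delta\in X$ and $\delta_e\notin X$, then $f_u+f_{u'}<0$. Valuation: for $p\in P_e$, $p^\pi$ is the set of values of $e$ whose $X$ contains $p$. Local condition at $u$: a tuple $\langle X^e,\{f^e_v\}_{v\in Inc(e)}\rangle_{e\in Inc(u)}$ belongs to $L_u$ iff: if $\delta_e\notin X^e$ for every $e\in Inc(u)$, then $\sum_{e\in Inc(u)}f^e_u\ge0$. -}

module Defs where

open import Level using (0ℓ)
open import Data.Nat using (ℕ)
open import Data.Fin using (Fin; _≟_) renaming (_<_ to _<ᶠ_)
open import Data.Fin.Subset using (Subset; _∈_; ⁅_⁆)
open import Data.Bool using (Bool; true; false; not; _∨_)
open import Data.Empty using (⊥)
open import Data.Unit using (⊤)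
open import Data.Product using (Σ; ∃; _×_; _,_; proj₁; proj₂)
open import Data.Sum using (_⊎_)
open import Data.List using (List; []; _∷_; map; foldr; allFin)
open import Data.List.Membership.Propositional renaming (_∈_ to _∈ₗ_)
open import Data.List.Relation.Unary.AllPairs using (AllPairs)
open import Relation.Nullary using (¬_; yes; no)
open import Relation.Binary.PropositionalEquality using (_≡_; _≢_)
open import Function.Bundles using (_⇔_)
open import Algebra.Structures using (IsCommutativeRing)
open import Relation.Binary.Structures using (IsStrictTotalOrder)

-- Real numbers: an arbitrary complete ordered field (the reals up to
-- isomorphism); the standard library has no real numbers.

record RealField : Set₁ where
  infixl 6 _+_
  infixl 7 _*_
  infix 4 _<_
  field
    Carrier : Set
    _+_ _*_ : Carrier → Carrier → Carrier
    -_      : Carrier → Carrier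
    0# 1#   : Carrier
    _<_     : Carrier → Carrier → Set
    isCommutativeRing : IsCommutativeRing _≡_ _+_ _*_ -_ 0# 1#
    0≢1     : 0# ≢ 1#
    inverse : ∀ x → x ≢ 0# → Σ Carrier λ y → x * y ≡ 1#
    isStrictTotalOrder : IsStrictTotalOrder _≡_ _<_
    +-mono-< : ∀ {x y} z → x < y → x + z < y + z
    *-pos    : ∀ {x y} → 0# < x → 0# < y → 0# < x * y
    complete : (S : Carrier → Set) → Σ Carrier S →
               Σ Carrier (λ b → ∀ x → S x → (x < b ⊎ x ≡ b)) →
               Σ Carrier (λ s → (∀ x → S x → (x < s ⊎ x ≡ s)) ×
                 (∀ b → (∀ x → S x → (x < b ⊎ x ≡ b)) → (s < b ⊎ s ≡ b)))

  _≤_ : Carrier → Carrier → Set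
  x ≤ y = x < y ⊎ x ≡ y

-- Graph notions (vertices Fin nV, edges Fin nE, each edge with its
-- two (possibly equal) endpoints)

module Graph {nV nE : ℕ} (ends : Fin nE → Fin nV × Fin nV) where

  V = Fin nV
  E = Fin nE

  Inc : E → V → Set
  Inc e v = v ≡ proj₁ (ends e) ⊎ v ≡ proj₂ (ends e)

  EdgeBetween : E → V → V → Set
  EdgeBetween e u u' = ends e ≡ (u , u') ⊎ ends e ≡ (u' , u)

  data Reach (excl : E → Set) : V → V → Set where
    here : ∀ {u} → Reach excl u u
    step : ∀ {u w t} (e : E) → ¬ excl e → Inc e u → Inc e w →
           Reach excl w t → Reach excl u t

  Connected : Set
  Connected = ∀ u w → Reach (λ _ → ⊥) u w

  IsBridge : E → Set
  IsBridge b = ¬ (∀ u w → Reach (_≡ b) u w)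

  InComp : E → V → E → Set
  InComp e v h = h ≢ e × Σ V (λ w → Inc h w × Reach (_≡ e) v w)

  -- paths from an edge to an edge: e₀ v₁ e₁ v₂ … vₖ eₖ
  record Path : Set where
    constructor path
    field
      start : E
      steps : List (V × E)

  edgesOf : Path → List E
  edgesOf (path s st) = s ∷ map proj₂ st

  verticesOf : Path → List V
  verticesOf (path s st) = map proj₁ st

  Linked : E → List (V × E) → Set
  Linked e [] = ⊤
  Linked e ((v , e') ∷ rest) = Inc e v × Inc e' v × Linked e' rest

  lastE : E → List (V × E) → E
  lastE e [] = e
  lastE e ((_ , e') ∷ rest) = lastE e' rest

  ValidPath : Path → E → E → Set
  ValidPath p a b =
    Path.start p ≡ a × lastE (Path.start p) (Path.steps p) ≡ b ×
    Linked (Path.start p) (Path.steps p) ×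
    AllPairs _≢_ (edgesOf p) × AllPairs _≢_ (verticesOf p)

  IsGateway : E → Subset nE → Subset nE → Set
  IsGateway g A B = ∀ a b → a ∈ A → b ∈ B → (p : Path) → ValidPath p a b →
                    g ∈ₗ edgesOf p

-- Signatures: letters each belong to exactly one P_e (given by `owner`)

record Signature : Set₁ where
  field
    nV nE     : ℕ
    ends      : Fin nE → Fin nV × Fin nV
    Letter    : Set
    owner     : Letter → Fin nE
  open Graph ends public
  field
    connected : Connected

module Logic (S : Signature) where
  open Signature S

  infixr 5 _⇒_
  data Fm : Set where
    ⊥'  : Fm
    var : Letter → Fm
    _⇒_ : Fm → Fm → Fm
    □   : E → Fm → Fm

  ¬' : Fm → Fm
  ¬' φ = φ ⇒ ⊥'

  _∨'_ : Fm → Fm → Fm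
  φ ∨' ψ = ¬' φ ⇒ ψ

  ⋁ : List Fm → Fm
  ⋁ = foldr _∨'_ ⊥'

  data InPhi (T : Subset nE) : Fm → Set where
    bot : InPhi T ⊥'
    letter : ∀ p → owner p ∈ T → InPhi T (var p)
    imp : ∀ {φ ψ} → InPhi T φ → InPhi T ψ → InPhi T (φ ⇒ ψ)
    box : ∀ t φ → t ∈ T → InPhi T (□ t φ)

  -- propositional tautology (letters and boxed formulas as atoms)
  eval : (Fm → Bool) → Fm → Bool
  eval v ⊥' = false
  eval v (φ ⇒ ψ) = not (eval v φ) ∨ eval v ψ
  eval v φ = v φ

  Tautology : Fm → Set
  Tautology φ = ∀ v → eval v φ ≡ true

  data ⊢_ : Fm → Set where
    taut  : ∀ {φ} → Tautology φ → ⊢ φ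
    truth : ∀ e φ → ⊢ (□ e φ ⇒ φ)
    posI  : ∀ e φ → ⊢ (□ e φ ⇒ □ e (□ e φ))
    negI  : ∀ e φ → ⊢ (¬' (□ e φ) ⇒ □ e (¬' (□ e φ)))
    dist  : ∀ e φ ψ → ⊢ (□ e (φ ⇒ ψ) ⇒ (□ e φ ⇒ □ e ψ))
    gate  : ∀ (A B : Subset nE) g e φ ψ → IsGateway g A B → e ∈ A →
            InPhi A φ → InPhi B ψ → ⊢ (□ e (φ ⇒ ψ) ⇒ (φ ⇒ □ g ψ))
    mp    : ∀ {φ ψ} → ⊢ (φ ⇒ ψ) → ⊢ φ → ⊢ ψ
    nec   : ∀ e {φ} → ⊢ φ → ⊢ □ e φ

  Pred : Set₁
  Pred = Fm → Set

  _⊆'_ : Pred → Pred → Set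
  X ⊆' Y = ∀ φ → X φ → Y φ

  data Der (X : Pred) : Fm → Set where
    thm : ∀ {φ} → ⊢ φ → Der X φ
    hyp : ∀ {φ} → X φ → Der X φ
    mpd : ∀ {φ ψ} → Der X (φ ⇒ ψ) → Der X φ → Der X ψ

  Consistent : Pred → Set
  Consistent X = ¬ Der X ⊥'

  MaxConsIn : Pred → Pred → Set₁
  MaxConsIn Sp X = X ⊆' Sp × Consistent X ×
    (∀ (Y : Pred) → X ⊆' Y → Y ⊆' Sp → Consistent Y → Y ⊆' X)

  -- δ ∈ Δ(Σ): disjuncts δ_e ∈ Φ(Σ,{e})
  InDelta : (E → Fm) → Set
  InDelta δ = ∀ e → InPhi ⁅ e ⁆ (δ e)

  bigδ : (E → Fm) → Fm
  bigδ δ = ⋁ (map δ (allFin nE))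

module Protocol (S : Signature) (R : RealField) where
  open Signature S
  open Logic S
  open RealField R

  -- Σ_{v ∈ Inc(e)} f v  (a loop has a single endpoint)
  sumInc : E → (V → Carrier) → Carrier
  sumInc e f with proj₁ (ends e) ≟ proj₂ (ends e)
  ... | yes _ = f (proj₁ (ends e))
  ... | no  _ = f (proj₁ (ends e)) + f (proj₂ (ends e))

  incB : E → V → Bool
  incB e u with u ≟ proj₁ (ends e) | u ≟ proj₂ (ends e)
  ... | no _ | no _ = false
  ... | _    | _    = true

  -- the unique strictly increasing list of exactly the edges satisfying P
  Enumerates : (E → Set) → List E → Set
  Enumerates P l = AllPairs _<ᶠ_ l × (∀ h → (h ∈ₗ l) ⇔ P h)

  module _ (δ : E → Fm) (F : Subset nE) where

    record Value (e : E) : Set₁ where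
      field
        X   : Pred
        f   : V → Carrier
        mcs : MaxConsIn (InPhi ⁅ e ⁆) X
        pos : (0# < sumInc e f) ⇔ X (δ e)
        b2a : IsBridge e → ¬ X (δ e) → sumInc e f ≡ 0#
        b2b : IsBridge e → ∀ u → Inc e u → f u < 0# →
              ∀ l → Enumerates (InComp e u) l → X (□ e (⋁ (map δ l)))
        b2c : IsBridge e → e ∈ F → X (□ e (bigδ δ)) → ¬ X (δ e) →
              f (proj₁ (ends e)) < 0# ⊎ f (proj₂ (ends e)) < 0#
        n3a : ¬ IsBridge e → sumInc e f < 0# → X (□ e (bigδ δ))
        n3b : ¬ IsBridge e → e ∈ F → X (□ e (bigδ δ)) → ¬ X (δ e) →
              sumInc e f < 0#

    sumAt : ((e : E) → Value e) → V → Carrier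
    sumAt val u = foldr (λ e acc → addIf (incB e u) (Value.f (val e) u) acc) 0# (allFin nE)
      where
        addIf : Bool → Carrier → Carrier → Carrier
        addIf true x acc = x + acc
        addIf false x acc = acc

    record Run : Set₁ where
      field
        val   : (e : E) → Value e
        local : ∀ u → (∀ e → Inc e u → ¬ Value.X (val e) (δ e)) →
                0# ≤ sumAt val u

    X : Run → E → Pred
    X r e = Value.X (Run.val r e)

    f : Run → E → V → Carrier
    f r e = Value.f (Run.val r e)

module Submission where

open import Defs
open import Data.Fin.Subset using (Subset; _∈_)
open import Relation.Nullary using (¬_)
open import Relation.Binary.PropositionalEquality using (_≡_)
open import Function.Bundles using (_⇔_)

open import Data.Nat using (zero; suc)
open import Data.Fin using (Fin; zero; suc; _≟_) renaming (_<_ to _<ᶠ_)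
open import Data.Fin.Subset.Properties using (x∈⁅x⁆)
open import Data.Bool using (true; false)
open import Data.Bool.Properties using (∨-zeroʳ)
open import Data.Empty using (⊥; ⊥-elim)
open import Data.Product using (Σ; _×_; _,_; proj₁; proj₂)
open import Data.Sum using (_⊎_; inj₁; inj₂)
open import Data.List using (List; []; _∷_; map; allFin; filter)
open import Data.List.Relation.Unary.Any using (Any; here; there)
open import Data.List.Relation.Unary.AllPairs using (AllPairs)
open import Data.List.Relation.Unary.AllPairs.Properties using (tabulate⁺-<; filter⁺)
open import Data.List.Relation.Binary.Subset.Propositional using (_⊆_)
open import Data.List.Relation.Binary.Subset.Propositional.Properties using (Any-resp-⊆)
open import Data.List.Membership.Propositional using () renaming (_∈_ to _∈ₗ_)
open import Data.List.Membership.Propositional.Properties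
  using (∈-map⁺; ∈-map⁻; ∈-allFin; ∈-filter⁺; ∈-filter⁻)
open import Relation.Nullary using (Dec; yes; no)
open import Relation.Nullary.Decidable using (¬¬-excluded-middle)
open import Relation.Unary using (Decidable)
open import Relation.Binary.PropositionalEquality
  using (refl; sym; trans; cong; subst; subst₂; module ≡-Reasoning)
open import Relation.Binary.Definitions using (tri<; tri≈; tri>)
open import Function.Base using (id; _∘_)
open import Function.Bundles using (mk⇔)
open import Algebra.Structures using (IsCommutativeRing)
open import Relation.Binary.Structures using (IsStrictTotalOrder)

-- Let h ∈ F be a bridge with endpoints a, b whose value
-- ⟨X, f⟩ has δ_h ∉ X.  By (2a) the endpoint values sum to 0, so either
-- both f a and f b vanish, or one of them is strictly negative; and f v = 0
-- at an endpoint v exactly when both vanish.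
--   (⇒) If both vanish, (2c) forbids □_h δ ∈ X.
--   (⇐) If some endpoint u has f u < 0, then (2b) puts □_h ⋁_{g∈C} δ_g
--       into X, C the edges of the component C^u_{-h}; since ⋁_{g∈C} δ_g → δ
--       is a tautology, X derives □_h δ, and X is deductively closed in
--       Φ(Σ,{h}), so □_h δ ∈ X.
-- Condition (2b) quantifies over an explicit enumeration of C, which can
-- only be built for a decidable predicate; because the goal of (⇐) is
-- stable (an equation proved by refuting its negation), decidability of
-- membership in C may be assumed classically via ¬¬-excluded-middle.

¬¬-decidable : ∀ n (P : Fin n → Set) → ¬ ¬ Decidable P
¬¬-decidable zero    P k = k (λ ())
¬¬-decidable (suc n) P k =
  ¬¬-decidable n (P ∘ suc) λ P∘suc? →
  ¬¬-excluded-middle λ P0? →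
  k λ { zero → P0? ; (suc i) → P∘suc? i }

enumerate : ∀ {n} {P : Fin n → Set} → Decidable P →
            Σ (List (Fin n)) λ l → AllPairs _<ᶠ_ l × (∀ i → (i ∈ₗ l) ⇔ P i)
enumerate {n} P? =
  filter P? (allFin n) ,
  filter⁺ P? (tabulate⁺-< id) ,
  λ i → mk⇔ (proj₂ ∘ ∈-filter⁻ P? {xs = allFin n}) (∈-filter⁺ P? (∈-allFin i))

module OrderedField (R : RealField) where
  open RealField R
  open IsCommutativeRing isCommutativeRing using (+-comm; +-identityˡ)
  open IsStrictTotalOrder isStrictTotalOrder using (compare)

  ≡0? : ∀ x → Dec (x ≡ 0#)
  ≡0? x with compare x 0#
  ... | tri< _ x≢0 _ = no x≢0
  ... | tri≈ _ x≡0 _ = yes x≡0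
  ... | tri> _ x≢0 _ = no x≢0

  zero-sum-zero : ∀ {a b} → a + b ≡ 0# → a ≡ 0# → b ≡ 0#
  zero-sum-zero {a} {b} a+b≡0 a≡0 = begin
    b      ≡⟨ sym (+-identityˡ b) ⟩
    0# + b ≡⟨ cong (_+ b) (sym a≡0) ⟩
    a + b  ≡⟨ a+b≡0 ⟩
    0#     ∎
    where open ≡-Reasoning

  zero-sum-negative : ∀ {a b} → a + b ≡ 0# → ¬ a ≡ 0# → a < 0# ⊎ b < 0#
  zero-sum-negative {a} {b} a+b≡0 a≢0 with compare a 0#
  ... | tri< a<0 _ _ = inj₁ a<0
  ... | tri≈ _ a≡0 _ = ⊥-elim (a≢0 a≡0)
  ... | tri> _ _ 0<a = inj₂ (subst₂ _<_ (+-identityˡ b) a+b≡0 (+-mono-< b 0<a))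

module Reasoning (S : Signature) where
  open Signature S
  open Logic S

  ⋁-true⁻ : ∀ v xs → eval v (⋁ xs) ≡ true → Any (λ φ → eval v φ ≡ true) xs
  ⋁-true⁻ v []       ()
  ⋁-true⁻ v (φ ∷ xs) ⋁≡true with eval v φ in φ≡true
  ... | true  = here φ≡true
  ... | false = there (⋁-true⁻ v xs ⋁≡true)

  ⋁-true⁺ : ∀ v xs → Any (λ φ → eval v φ ≡ true) xs → eval v (⋁ xs) ≡ true
  ⋁-true⁺ v (φ ∷ xs) (here φ≡true) rewrite φ≡true = refl
  ⋁-true⁺ v (φ ∷ xs) (there any) rewrite ⋁-true⁺ v xs any = ∨-zeroʳ _

  valid-implication : ∀ {φ ψ} → (∀ v → eval v φ ≡ true → eval v ψ ≡ true) →
                      Tautology (φ ⇒ ψ)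
  valid-implication {φ} {ψ} entails = valid
    where
    valid : ∀ v → eval v (φ ⇒ ψ) ≡ true
    valid v with eval v φ in φ≡true
    ... | false = refl
    ... | true  = entails v φ≡true

  ⋁-mono : ∀ {xs ys} → xs ⊆ ys → Tautology (⋁ xs ⇒ ⋁ ys)
  ⋁-mono {xs} {ys} xs⊆ys = valid-implication {⋁ xs} {⋁ ys} λ v →
    ⋁-true⁺ v ys ∘ Any-resp-⊆ xs⊆ys ∘ ⋁-true⁻ v xs

  partial-disjunction : ∀ (δ : E → Fm) l → ⊢ (⋁ (map δ l) ⇒ bigδ δ)
  partial-disjunction δ l = taut (⋁-mono λ φ∈ → sub (∈-map⁻ δ φ∈))
    where
    sub : ∀ {φ} → Σ E (λ e → e ∈ₗ l × φ ≡ δ e) → φ ∈ₗ map δ (allFin nE)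
    sub (e , _ , refl) = ∈-map⁺ δ (∈-allFin e)

  □-mono : ∀ {X e φ ψ} → ⊢ (φ ⇒ ψ) → Der X (□ e φ) → Der X (□ e ψ)
  □-mono {e = e} {φ} {ψ} φ⇒ψ d = mpd (mpd (thm (dist e φ ψ)) (thm (nec e φ⇒ψ))) d

  _∪⁅_⁆ : Pred → Fm → Pred
  (X ∪⁅ φ ⁆) ψ = X ψ ⊎ ψ ≡ φ

  cut : ∀ {X φ ψ} → Der X φ → Der (X ∪⁅ φ ⁆) ψ → Der X ψ
  cut d (thm t)           = thm t
  cut d (hyp (inj₁ x))    = hyp x
  cut d (hyp (inj₂ refl)) = d
  cut d (mpd p q)         = mpd (cut d p) (cut d q)

  mcs-closed : ∀ {Sp X φ} → MaxConsIn Sp X → Der X φ → Sp φ → X φ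
  mcs-closed {Sp} {X} {φ} (X⊆Sp , cons , maximal) d φ∈Sp =
    maximal (X ∪⁅ φ ⁆) (λ _ → inj₁) extended⊆Sp (cons ∘ cut d) φ (inj₂ refl)
    where
    extended⊆Sp : (X ∪⁅ φ ⁆) ⊆' Sp
    extended⊆Sp ψ (inj₁ x)    = X⊆Sp ψ x
    extended⊆Sp ψ (inj₂ refl) = φ∈Sp

module EndpointSums (S : Signature) (R : RealField) where
  open Signature S
  open RealField R
  open IsCommutativeRing isCommutativeRing using (+-comm)
  open OrderedField R
  open Protocol S R using (sumInc)

  VanishesAt : E → (V → Carrier) → Set
  VanishesAt e g = g (proj₁ (ends e)) ≡ 0# × g (proj₂ (ends e)) ≡ 0#

  vanishes-at-endpoint : ∀ {e g v} → VanishesAt e g → Inc e v → g v ≡ 0#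
  vanishes-at-endpoint (ga≡0 , _) (inj₁ refl) = ga≡0
  vanishes-at-endpoint (_ , gb≡0) (inj₂ refl) = gb≡0

  zero-sum-endpoints : ∀ e g → sumInc e g ≡ 0# →
                       VanishesAt e g ⊎ g (proj₁ (ends e)) + g (proj₂ (ends e)) ≡ 0#
  zero-sum-endpoints e g sum≡0 with proj₁ (ends e) ≟ proj₂ (ends e)
  ... | yes a≡b = inj₁ (sum≡0 , subst (λ w → g w ≡ 0#) a≡b sum≡0)
  ... | no  _   = inj₂ sum≡0

  zero-at-endpoint : ∀ {e g v} → sumInc e g ≡ 0# → Inc e v → g v ≡ 0# → VanishesAt e g
  zero-at-endpoint {e} {g} sum≡0 v∈e gv≡0 with zero-sum-endpoints e g sum≡0 | v∈e
  ... | inj₁ vanishes | _          = vanishes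
  ... | inj₂ ga+gb≡0  | inj₁ refl = gv≡0 , zero-sum-zero ga+gb≡0 gv≡0
  ... | inj₂ ga+gb≡0  | inj₂ refl = zero-sum-zero (trans (+-comm _ _) ga+gb≡0) gv≡0 , gv≡0

  negative-endpoint : ∀ {e g} → sumInc e g ≡ 0# → ¬ VanishesAt e g →
                      Σ V λ u → Inc e u × g u < 0#
  negative-endpoint {e} {g} sum≡0 ¬vanishes with zero-sum-endpoints e g sum≡0
  ... | inj₁ vanishes = ⊥-elim (¬vanishes vanishes)
  ... | inj₂ ga+gb≡0 with ≡0? (g (proj₁ (ends e)))
  ...   | yes ga≡0 = ⊥-elim (¬vanishes (ga≡0 , zero-sum-zero ga+gb≡0 ga≡0))
  ...   | no  ga≢0 with zero-sum-negative ga+gb≡0 ga≢0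
  ...     | inj₁ ga<0 = proj₁ (ends e) , inj₁ refl , ga<0
  ...     | inj₂ gb<0 = proj₂ (ends e) , inj₂ refl , gb<0

-- A single value ⟨X, f⟩ of a bridge h ∈ F with δ_h ∉ X.
module BridgeValue (S : Signature) (R : RealField) (δ : Signature.E S → Logic.Fm S)
                   (F : Subset (Signature.nE S)) {h : Signature.E S}
                   (val : Protocol.Value S R δ F h) (bridge : Signature.IsBridge S h)
                   (h∈F : h ∈ F) (δh∉X : ¬ Protocol.Value.X val (δ h)) where
  open Signature S
  open Logic S
  open RealField R
  open IsStrictTotalOrder isStrictTotalOrder using (irrefl)
  open OrderedField R
  open Reasoning S
  open EndpointSums S R
  open Protocol.Value val

  vanishing-excludes-□δ : VanishesAt h f → ¬ X (□ h (bigδ δ))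
  vanishing-excludes-□δ (fa≡0 , fb≡0) □δ∈X with b2c bridge h∈F □δ∈X δh∉X
  ... | inj₁ fa<0 = irrefl fa≡0 fa<0
  ... | inj₂ fb<0 = irrefl fb≡0 fb<0

  -- A negative endpoint forces □_h δ ∈ X: (2b) gives □_h of the disjunction
  -- over the component, which implies □_h δ.  Enumerating the component
  -- needs decidability, hence the double negation.
  negative-endpoint-forces-□δ : ∀ {u} → Inc h u → f u < 0# → ¬ ¬ X (□ h (bigδ δ))
  negative-endpoint-forces-□δ {u} u∈h fu<0 □δ∉X =
    ¬¬-decidable nE (InComp h u) λ inComp? →
    let (component , increasing , members) = enumerate inComp?
        □component∈X = b2b bridge u u∈h fu<0 component (increasing , members)
        □δ-derived = □-mono (partial-disjunction δ component) (hyp □component∈X)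
    in □δ∉X (mcs-closed mcs □δ-derived (box h (bigδ δ) (x∈⁅x⁆ h)))

  zero-iff-□δ∉X : ∀ {v} → Inc h v → (f v ≡ 0#) ⇔ (¬ X (□ h (bigδ δ)))
  zero-iff-□δ∉X {v} v∈h = mk⇔ forward backward
    where
    sum≡0 = b2a bridge δh∉X

    forward : f v ≡ 0# → ¬ X (□ h (bigδ δ))
    forward = vanishing-excludes-□δ ∘ zero-at-endpoint sum≡0 v∈h

    backward : ¬ X (□ h (bigδ δ)) → f v ≡ 0#
    backward □δ∉X with ≡0? (f v)
    ... | yes fv≡0 = fv≡0
    ... | no  fv≢0 =
      let (u , u∈h , fu<0) = negative-endpoint sum≡0 λ vanishes → fv≢0 (vanishes-at-endpoint vanishes v∈h)
      in ⊥-elim (negative-endpoint-forces-□δ u∈h fu<0 □δ∉X)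

edge-endpoint : ∀ {S : Signature} {h v v'} →
                Signature.EdgeBetween S h v v' → Signature.Inc S h v
edge-endpoint (inj₁ refl) = inj₁ refl
edge-endpoint (inj₂ refl) = inj₂ refl

lemma11 : (S : Signature) (R : RealField) (δ : Signature.E S → Logic.Fm S) →
          Logic.InDelta S δ → (F : Subset (Signature.nE S)) →
          (r : Protocol.Run S R δ F) →
          (h : Signature.E S) (v v' : Signature.V S) →
          Signature.EdgeBetween S h v v' → h ∈ F → Signature.IsBridge S h →
          ¬ Protocol.X S R δ F r h (δ h) →
          (Protocol.f S R δ F r h v ≡ RealField.0# R) ⇔
            (¬ Protocol.X S R δ F r h (Logic.□ h (Logic.bigδ S δ)))
lemma11 S R δ _ F r h v v' v-h-v' h∈F bridge δh∉X =
  BridgeValue.zero-iff-□δ∉X S R δ F (Protocol.Run.val r h) bridge h∈F δh∉X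
    (edge-endpoint {S} v-h-v')
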